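{- Let $n\ge 2$ and let $B_n$ be the group of signed permutations of $[\pm n]$ (bijections $w$ of $\{ -n,\dots,-1,1,\dots,n\}$ with $w(-a)=-w(a)$). Define $f^B_0$ by $f^B_0(1)=-1$, $f^B_0(m)=m$ for $2\le m\le n$, and for $1\le i\le n-1$ define $f^B_i$ by $f^B_i(m)=-(i+2-m)$ for $1\le m\le i+1$ and $f^B_i(m)=m$ for $i+1<m\le n$. The burnt pancake graph of $B_n$ is the Cayley graph with vertex set $B_n$ in which $w$ and $wf^B_i$ are joined by an edge labelled $f^B_i$, for each $w\in B_n$ and $0\le i\le n-1$. Let $0\le i<j<n$, let $k$ be the order of $f^B_if^B_j$ in $B_n$, and let $\ell=2k$. Then the burnt pancake graph of $B_n$ contains a maximal set of $\frac{2^n n!}{\ell}$ independent (pairwise vertex-disjoint) $\ell$-cycles of the form $(f^B_if^B_j)^k$, i.e. cycles $w,\ wf^B_i,\ wf^B_if^B_j,\ wf^B_if^B_jf^B_i,\ \dots$ whose successive edges are alternately labelled $f^B_i$ and $f^B_j$.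
   Context: Signed permutations are composed as functions. -}

module Defs where

open import Data.Bool using (Bool; true; false; _xor_)
open import Data.Nat using (ℕ; zero; suc; _≤_; _<_; _≤?_; _∸_; _*_)
open import Data.Nat.Properties using (≤-<-trans; m∸n≤m)
open import Data.Fin using (Fin; toℕ; fromℕ<)
open import Data.Fin.Properties using (toℕ<n)
open import Data.Product using (_×_; _,_; Σ)
open import Data.List using (List)
open import Data.List.Relation.Unary.All using (All)
open import Data.List.Relation.Unary.Any using (Any)
open import Data.List.Relation.Unary.AllPairs using (AllPairs)
open import Relation.Nullary using (¬_; yes; no)
open import Relation.Binary.PropositionalEquality using (_≡_; _≗_)
open import Function.Definitions using (Bijective)

-- [±n] : an element (s , a) stands for the integer  ±(toℕ a + 1),
-- with sign s = false meaning positive and s = true meaning negative.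
PM : ℕ → Set
PM n = Bool × Fin n

neg : ∀ {n} → PM n → PM n
neg (s , a) = (Data.Bool.not s , a)

record SignedPerm (n : ℕ) : Set where
  field
    fun   : PM n → PM n
    odd   : ∀ x → fun (neg x) ≡ neg (fun x)
    bij   : Bijective _≡_ _≡_ fun
open SignedPerm public

Fn : ℕ → Set
Fn n = PM n → PM n

idF : ∀ {n} → Fn n
idF x = x

_·_ : ∀ {n} → Fn n → Fn n → Fn n
(g · h) x = g (h x)
infixl 7 _·_

pow : ∀ {n} → ℕ → Fn n → Fn n
pow zero    g = idF
pow (suc m) g = g · pow m g

-- f^B_i on a positive element m = toℕ a + 1 (i as Fin n is the index i, 0 ≤ i ≤ n-1):
--   m ≤ i+1  ↦  -(i+2-m)   (index i ∸ toℕ a, negative sign)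
--   m > i+1  ↦  m
-- For i = 0 this is exactly f^B_0 : 1 ↦ -1, m ↦ m (m ≥ 2).
fpos : ∀ {n} → Fin n → Fin n → PM n
fpos {n} i a with toℕ a ≤? toℕ i
... | yes _ = (true , fromℕ< (≤-<-trans (m∸n≤m (toℕ i) (toℕ a)) (toℕ<n i)))
... | no  _ = (false , a)

fB : ∀ {n} → Fin n → Fn n
fB i (s , a) with fpos i a
... | (t , b) = (t xor s , b)

-- The alternating word: alt i j t = g_1 g_2 ... g_t with g_odd = f_i, g_even = f_j,
-- so the t-th vertex of the walk from w is  w f_i f_j f_i ...  (t letters).
letter : ∀ {n} → Fin n → Fin n → ℕ → Fn n
letter i j zero          = fB i
letter i j (suc zero)    = fB j
letter i j (suc (suc t)) = letter i j t

alt : ∀ {n} → Fin n → Fin n → ℕ → Fn n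
alt i j zero    = idF
alt i j (suc t) = alt i j t · letter i j t

vert : ∀ {n} → Fin n → Fin n → SignedPerm n → ℕ → Fn n
vert i j w t = fun w · alt i j t

IsOrder : ∀ {n} → ℕ → Fn n → Set
IsOrder k g = (1 ≤ k) × (pow k g ≗ idF) × (∀ m → 1 ≤ m → m < k → ¬ (pow m g ≗ idF))

IsAltCycle : ∀ {n} → Fin n → Fin n → ℕ → SignedPerm n → Set
IsAltCycle i j ℓ w =
  (vert i j w ℓ ≗ fun w) ×
  (∀ s t → s < ℓ → t < ℓ → vert i j w s ≗ vert i j w t → s ≡ t)

VertexDisjoint : ∀ {n} → Fin n → Fin n → ℕ → SignedPerm n → SignedPerm n → Set
VertexDisjoint i j ℓ v w =
  ∀ s t → s < ℓ → t < ℓ → ¬ (vert i j v s ≗ vert i j w t)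

-- a maximal set of independent (pairwise vertex-disjoint) ℓ-cycles of the
-- form (f_i f_j)^k, each cycle given by its starting vertex
MaximalIndependentAltCycles : ∀ {n} → Fin n → Fin n → ℕ → List (SignedPerm n) → Set
MaximalIndependentAltCycles i j ℓ cs =
  All (IsAltCycle i j ℓ) cs ×
  AllPairs (VertexDisjoint i j ℓ) cs ×
  (∀ w → IsAltCycle i j ℓ w → Any (λ c → ¬ VertexDisjoint i j ℓ c w) cs)

module Submission where

-- The alternating walk w, w f_i, w f_i f_j, ... stays inside the orbit of w under right
-- multiplication by the dihedral group generated by the involutions f_i and f_j. An alternating
-- word of odd length is conjugate to a single flip, so it is never the identity, and one of even
-- length 2q starting at an even position is (f_i f_j)^q; since f_i f_j has order k, the walk
-- closes up after exactly 2k steps and visits 2k distinct vertices, so every orbit is one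
-- (f_i f_j)^k-cycle. Picking greedily one starting vertex per orbit gives pairwise vertex-disjoint
-- cycles that meet every such cycle, and double counting their vertices gives
-- |B_n| / 2k = 2^n n! / 2k of them. The order |B_n| = 2^n n! comes from writing a signed
-- permutation of [±(n+1)] uniquely as the transposition of 1 and c, a possible sign change of 1,
-- and a signed permutation fixing ±1.

open import Defs

module BurntPancakeGraph where

  open import Level using (Level)
  open import Data.Bool using (Bool; true; false; _xor_)
  import Data.Bool.Properties as Bool
  open import Data.Bool.Properties using (not-distribˡ-xor; not-distribʳ-xor; xor-assoc; xor-same; xor-identityʳ)
  open import Data.Empty using (⊥-elim)
  open import Data.Fin using (Fin; zero; suc; toℕ)
  import Data.Fin.Properties as Fin
  open import Data.Fin.Properties using (suc-injective; toℕ-fromℕ<; toℕ-injective)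
  open import Data.Fin.Permutation using (Permutation; _⟨$⟩ʳ_; _⟨$⟩ˡ_; inverseˡ; inverseʳ; transpose; flip)
  open import Data.List using (List; []; _∷_; length; map; concat; applyUpTo; cartesianProduct; allFin)
  open import Data.List.Properties
    using (length-++; length-map; length-tabulate; length-applyUpTo; length-removeAt′; map-∘)
  open import Data.List.Relation.Unary.All as All using (All; []; _∷_)
  import Data.List.Relation.Unary.All.Properties as All
  open import Data.List.Relation.Unary.Any as Any using (Any; here; there)
  import Data.List.Relation.Unary.Any.Properties as Any
  open import Data.List.Relation.Unary.AllPairs as AllPairs using (AllPairs; []; _∷_)
  import Data.List.Relation.Unary.AllPairs.Properties as AllPairs
  open import Data.List.Relation.Unary.Unique.Propositional using () renaming (Unique to Unique≡)
  import Data.List.Relation.Unary.Unique.Propositional.Properties as Unique≡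
  open import Data.List.Relation.Unary.Unique.Setoid using (Unique)
  import Data.List.Relation.Unary.Unique.Setoid.Properties as Unique
  open import Data.List.Membership.Propositional using () renaming (_∈_ to _∈≡_)
  open import Data.List.Membership.Propositional.Properties using (∈-cartesianProduct⁺; ∈-allFin)
  open import Data.List.Membership.Setoid.Properties using (∈-map⁺; ∈-map⁻; ∈-resp-≈; All[≉]⇒∉)
  open import Data.Nat using (ℕ; zero; suc; _+_; _*_; _^_; _!; _≤_; _<_; _≤?_; _∸_; s≤s; z≤n)
  open import Data.Nat.Properties
    using ( ≤-refl; ≤-reflexive; ≤-trans; ≤-antisym; <-trans; <-cmp; n<1+n; ≰⇒>; <⇒≱
          ; m≤m+n; m≤n+m; m≤n⇒m<n∨m≡n; m≤n⇒∃[o]m+o≡n; m∸n≤m; m∸[m∸n]≡n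
          ; +-comm; +-suc; +-identityʳ; +-mono-≤; anyUpTo?)
  open import Data.Nat.Tactic.RingSolver using (solve-∀)
  open import Data.Product using (_,_; proj₁; proj₂; ∃; _×_)
  open import Data.Product.Properties using (≡-dec)
  open import Data.Sum using (_⊎_; inj₁; inj₂)
  open import Data.Unit using (⊤; tt)
  open import Function using (_∘_)
  open import Function.Consequences.Propositional using (strictlySurjective⇒surjective)
  import Function.Construct.Composition as Composition
  open import Relation.Binary using (tri<; tri≈; tri>)
  open import Relation.Binary.Bundles using (Setoid)
  open import Relation.Binary.PropositionalEquality
  open import Relation.Nullary using (¬_; Dec; yes; no; contradiction; map′; _×-dec_)
  open import Relation.Nullary.Decidable using (dec-true)

  -- Counting duplicate-free lists

  module _ {c ℓ : Level} (S : Setoid c ℓ) where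
    open Setoid S using (_≈_) renaming (refl to ≈-refl; sym to ≈-sym; trans to ≈-trans)
    open import Data.List.Membership.Setoid S using (_∈_)
    open import Data.List.Relation.Binary.Subset.Setoid S using (_⊆_)

    ∈-─ : ∀ {x y ys} (x∈ys : x ∈ ys) → y ∈ ys → ¬ y ≈ x → y ∈ (ys Any.─ x∈ys)
    ∈-─ (here x≈z) (here y≈z) y≉x = ⊥-elim (y≉x (≈-trans y≈z (≈-sym x≈z)))
    ∈-─ (here _)   (there y∈) _   = y∈
    ∈-─ (there _)  (here y≈z) _   = here y≈z
    ∈-─ (there x∈) (there y∈) y≉x = there (∈-─ x∈ y∈ y≉x)

    Unique∧⊆⇒length≤ : ∀ {xs ys} → Unique S xs → xs ⊆ ys → length xs ≤ length ys
    Unique∧⊆⇒length≤ {[]}         _          _     = z≤n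
    Unique∧⊆⇒length≤ {x ∷ xs} {ys} (x≉xs ∷ u) xs⊆ys =
      subst (suc (length xs) ≤_) (sym (length-removeAt′ ys (Any.index x∈ys)))
        (s≤s (Unique∧⊆⇒length≤ u λ y∈xs →
          ∈-─ x∈ys (xs⊆ys (there y∈xs)) λ y≈x → All[≉]⇒∉ S x≉xs (∈-resp-≈ S y≈x y∈xs)))
      where
      x∈ys : x ∈ ys
      x∈ys = xs⊆ys (here ≈-refl)

  length-cartesianProduct : ∀ {a b} {A : Set a} {B : Set b} (xs : List A) (ys : List B) →
                            length (cartesianProduct xs ys) ≡ length xs * length ys
  length-cartesianProduct []       ys = refl
  length-cartesianProduct (x ∷ xs) ys =
    trans (length-++ (map (x ,_) ys)) (cong₂ _+_ (length-map (x ,_) ys) (length-cartesianProduct xs ys))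

  FnSetoid : ℕ → Setoid _ _
  FnSetoid n = PM n →-setoid PM n

  _≗?_ : ∀ {n} (f g : Fn n) → Dec (f ≗ g)
  f ≗? g = map′ (λ (f≗g⁺ , f≗g⁻) → λ { (false , a) → f≗g⁺ a ; (true , a) → f≗g⁻ a })
                (λ f≗g → (λ a → f≗g (false , a)) , (λ a → f≗g (true , a)))
                (Fin.all? (λ a → f (false , a) ≟ g (false , a)) ×-dec
                 Fin.all? (λ a → f (true , a) ≟ g (true , a)))
    where _≟_ = ≡-dec Bool._≟_ Fin._≟_

  -- The signed permutation group B_n and its order

  injective : ∀ {n} (w : SignedPerm n) {x y} → fun w x ≡ fun w y → x ≡ y
  injective w = proj₁ (bij w)

  signedInvolution : ∀ {n} (h : Fn n) → (∀ x → h (neg x) ≡ neg (h x)) → (∀ x → h (h x) ≡ x) →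
                     SignedPerm n
  signedInvolution h h-odd h-inv = record
    { fun = h
    ; odd = h-odd
    ; bij = (λ {x} {y} hx≡hy → trans (sym (h-inv x)) (trans (cong h hx≡hy) (h-inv y)))
          , strictlySurjective⇒surjective (λ y → h y , h-inv y)
    }

  idˢ : ∀ {n} → SignedPerm n
  idˢ = signedInvolution idF (λ _ → refl) (λ _ → refl)

  infixl 7 _∘ˢ_
  _∘ˢ_ : ∀ {n} → SignedPerm n → SignedPerm n → SignedPerm n
  v ∘ˢ w = record
    { fun = fun v · fun w
    ; odd = λ x → trans (cong (fun v) (odd w x)) (odd v (fun w x))
    ; bij = Composition.bijective _≡_ _≡_ _≡_ (bij w) (bij v)
    }

  unsigned : ∀ {n} → Permutation n n → SignedPerm n
  unsigned π = record
    { fun = λ (s , a) → (s , π ⟨$⟩ʳ a)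
    ; odd = λ _ → refl
    ; bij = (λ {(s , a)} {(t , b)} eq → cong₂ _,_ (cong proj₁ eq)
               (trans (sym (inverseˡ π)) (trans (cong (λ (_ , c) → π ⟨$⟩ˡ c) eq) (inverseˡ π))))
          , strictlySurjective⇒surjective (λ (s , a) → (s , π ⟨$⟩ˡ a) , cong (s ,_) (inverseʳ π))
    }

  transpose-first : ∀ {n} (c : Fin (suc n)) → transpose c zero ⟨$⟩ʳ c ≡ zero
  transpose-first c rewrite dec-true (c Fin.≟ c) refl = refl

  flipF₀ : ∀ {n} → Bool → Fn (suc n)
  flipF₀ σ (s , zero)  = (s xor σ , zero)
  flipF₀ σ (s , suc a) = (s , suc a)

  flipF₀-involutive : ∀ {n} σ (x : PM (suc n)) → flipF₀ σ (flipF₀ σ x) ≡ x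
  flipF₀-involutive σ (s , zero)  = cong (_, zero)
    (trans (xor-assoc s σ σ) (trans (cong (s xor_) (xor-same σ)) (xor-identityʳ s)))
  flipF₀-involutive σ (s , suc a) = refl

  flip₀ : ∀ {n} → Bool → SignedPerm (suc n)
  flip₀ σ = signedInvolution (flipF₀ σ)
    (λ { (s , zero) → cong (_, zero) (sym (not-distribˡ-xor s σ)) ; (s , suc a) → refl })
    (flipF₀-involutive σ)

  sucₚ : ∀ {n} → PM n → PM (suc n)
  sucₚ (s , a) = (s , suc a)

  sucₚ-injective : ∀ {n} {x y : PM n} → sucₚ x ≡ sucₚ y → x ≡ y
  sucₚ-injective eq = cong₂ _,_ (cong proj₁ eq) (suc-injective (cong proj₂ eq))

  liftF : ∀ {n} → Fn n → Fn (suc n)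
  liftF h (s , zero)  = (s , zero)
  liftF h (s , suc a) = sucₚ (h (s , a))

  liftF-cong : ∀ {n} {h h′ : Fn n} → h ≗ h′ → liftF h ≗ liftF h′
  liftF-cong h≗h′ (s , zero)  = refl
  liftF-cong h≗h′ (s , suc a) = cong sucₚ (h≗h′ (s , a))

  lift : ∀ {n} → SignedPerm n → SignedPerm (suc n)
  lift w = record
    { fun = liftF (fun w)
    ; odd = λ { (s , zero) → refl ; (s , suc a) → cong sucₚ (odd w (s , a)) }
    ; bij = lift-injective , strictlySurjective⇒surjective lift-surjective
    }
    where
    lift-injective : ∀ {x y} → liftF (fun w) x ≡ liftF (fun w) y → x ≡ y
    lift-injective {s , zero}  {t , zero}  eq = eq
    lift-injective {s , zero}  {t , suc b} ()
    lift-injective {s , suc a} {t , zero}  ()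
    lift-injective {s , suc a} {t , suc b} eq = cong sucₚ (injective w (sucₚ-injective eq))
    lift-surjective : ∀ y → ∃ λ x → liftF (fun w) x ≡ y
    lift-surjective (s , zero)  = (s , zero) , refl
    lift-surjective (s , suc b) with proj₂ (bij w) (s , b)
    ... | x , wx≡y = sucₚ x , cong sucₚ (wx≡y refl)

  -- The first argument is a junk value for zero: restriction is only applied to maps fixing ±1.
  predOr : ∀ {n} → Fin n → Fin (suc n) → Fin n
  predOr a zero    = a
  predOr a (suc b) = b

  restrictF : ∀ {n} → Fn (suc n) → Fn n
  restrictF h (s , a) = (proj₁ (h (sucₚ (s , a))) , predOr a (proj₂ (h (sucₚ (s , a)))))

  module Restriction {n} (w : SignedPerm (suc n)) (fixes-one : fun w (false , zero) ≡ (false , zero)) where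

    fixes-±one : ∀ s → fun w (s , zero) ≡ (s , zero)
    fixes-±one false = fixes-one
    fixes-±one true  = trans (odd w (false , zero)) (cong neg fixes-one)

    liftF-restrictF : liftF (restrictF (fun w)) ≗ fun w
    liftF-restrictF (s , zero)  = sym (fixes-±one s)
    liftF-restrictF (s , suc a) with fun w (s , suc a) in eq
    ... | (t , suc b) = refl
    ... | (t , zero)  with () ← injective w (trans eq (sym (fixes-±one t)))

    restrict : SignedPerm n
    restrict = record
      { fun = restrictF (fun w)
      ; odd = λ (s , a) → cong (λ (t , b) → (t , predOr a b)) (odd w (s , suc a))
      ; bij = restrict-injective , strictlySurjective⇒surjective restrict-surjective
      }
      where
      restrict-injective : ∀ {x y} → restrictF (fun w) x ≡ restrictF (fun w) y → x ≡ y
      restrict-injective {x} {y} eq = sucₚ-injective (injective w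
        (trans (sym (liftF-restrictF (sucₚ x))) (trans (cong sucₚ eq) (liftF-restrictF (sucₚ y)))))
      restrict-surjective : ∀ y → ∃ λ x → restrictF (fun w) x ≡ y
      restrict-surjective y with proj₂ (bij w) (sucₚ y)
      ... | (s , suc a) , wx≡y = (s , a) , sucₚ-injective (trans (liftF-restrictF (s , suc a)) (wx≡y refl))
      ... | (s , zero)  , wx≡y with () ← trans (sym (fixes-±one s)) (wx≡y refl)

  Code : ℕ → Set
  Code zero    = ⊤
  Code (suc n) = Fin (suc n) × Bool × Code n

  decode : ∀ {n} → Code n → SignedPerm n
  decode {zero}  _           = idˢ
  decode {suc n} (c , σ , x) = unsigned (transpose zero c) ∘ˢ flip₀ σ ∘ˢ lift (decode x)

  decode-injective : ∀ {n} (x y : Code n) → fun (decode x) ≗ fun (decode y) → x ≡ y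
  decode-injective {zero}  _           _            _     = refl
  decode-injective {suc n} (c , σ , x) (c′ , σ′ , y) dx≗dy with dx≗dy (false , zero)
  ... | refl = cong (λ z → c , σ , z) (decode-injective x y λ p → sucₚ-injective (lift-eq (sucₚ p)))
    where
    lift-eq : ∀ p → liftF (fun (decode x)) p ≡ liftF (fun (decode y)) p
    lift-eq p = injective (flip₀ σ) (injective (unsigned (transpose zero c)) (dx≗dy p))

  decode-surjective : ∀ {n} (w : SignedPerm n) → ∃ λ x → fun w ≗ fun (decode x)
  decode-surjective {zero}  w = tt , λ ()
  decode-surjective {suc n} w = (c , σ , x) , λ p → begin
      fun w p                                        ≡⟨ τ-τ⁻¹ (fun w p) ⟨
      τF (τ⁻¹F (fun w p))                            ≡⟨ cong τF (flipF₀-involutive σ (τ⁻¹F (fun w p))) ⟨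
      τF (flipF₀ σ (fun w₀ p))                       ≡⟨ cong (τF ∘ flipF₀ σ) (liftF-restrictF p) ⟨
      τF (flipF₀ σ (liftF (restrictF (fun w₀)) p))   ≡⟨ cong (τF ∘ flipF₀ σ) (liftF-cong restrict≗x p) ⟩
      fun (decode (c , σ , x)) p                     ∎
    where
    open ≡-Reasoning
    σ = proj₁ (fun w (false , zero))
    c = proj₂ (fun w (false , zero))
    τ = transpose zero c
    τF = fun (unsigned τ)
    τ⁻¹F = fun (unsigned (flip τ))
    τ-τ⁻¹ : ∀ q → τF (τ⁻¹F q) ≡ q
    τ-τ⁻¹ (s , a) = cong (s ,_) (inverseʳ τ)
    w₀ = flip₀ σ ∘ˢ unsigned (flip τ) ∘ˢ w
    fixes-one : fun w₀ (false , zero) ≡ (false , zero)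
    fixes-one = trans (cong (λ a → flipF₀ σ (σ , a)) (transpose-first c)) (cong (_, zero) (xor-same σ))
    open Restriction w₀ fixes-one
    x = proj₁ (decode-surjective restrict)
    restrict≗x = proj₂ (decode-surjective restrict)

  codes : ∀ n → List (Code n)
  codes zero    = tt ∷ []
  codes (suc n) = cartesianProduct (allFin (suc n)) (cartesianProduct (false ∷ true ∷ []) (codes n))

  codes-unique : ∀ n → Unique≡ (codes n)
  codes-unique zero    = [] ∷ []
  codes-unique (suc n) = Unique≡.cartesianProduct⁺ (Unique≡.allFin⁺ (suc n))
    (Unique≡.cartesianProduct⁺ (((λ ()) ∷ []) ∷ [] ∷ []) (codes-unique n))

  codes-complete : ∀ {n} (x : Code n) → x ∈≡ codes n
  codes-complete {zero}  tt          = here refl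
  codes-complete {suc n} (c , σ , x) =
    ∈-cartesianProduct⁺ (∈-allFin c) (∈-cartesianProduct⁺ (bool∈ σ) (codes-complete x))
    where
    bool∈ : ∀ b → b ∈≡ (false ∷ true ∷ [])
    bool∈ false = here refl
    bool∈ true  = there (here refl)

  length-codes : ∀ n → length (codes n) ≡ 2 ^ n * n !
  length-codes zero    = refl
  length-codes (suc n) = begin
    length (codes (suc n))
      ≡⟨ length-cartesianProduct (allFin (suc n)) signs×codes ⟩
    length (allFin (suc n)) * length signs×codes
      ≡⟨ cong₂ _*_ (length-tabulate {n = suc n} (λ a → a)) (length-cartesianProduct (false ∷ true ∷ []) (codes n)) ⟩
    suc n * (2 * length (codes n))
      ≡⟨ cong (λ m → suc n * (2 * m)) (length-codes n) ⟩
    suc n * (2 * (2 ^ n * n !))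
      ≡⟨ regroup (suc n) (2 ^ n) (n !) ⟩
    2 ^ suc n * suc n !
      ∎
    where
    open ≡-Reasoning
    signs×codes = cartesianProduct (false ∷ true ∷ []) (codes n)
    regroup : ∀ a b c → a * (2 * (b * c)) ≡ (2 * b) * (a * c)
    regroup = solve-∀

  signedPerms : ∀ n → List (SignedPerm n)
  signedPerms n = map decode (codes n)

  signedPerms-unique : ∀ n → Unique (FnSetoid n) (map fun (signedPerms n))
  signedPerms-unique n = subst (Unique (FnSetoid n)) (map-∘ (codes n))
    (Unique.map⁺ (setoid (Code n)) (FnSetoid n) (decode-injective _ _) (codes-unique n))

  module _ {n : ℕ} where
    open import Data.List.Membership.Setoid (FnSetoid n) using (_∈_)

    signedPerms-complete : (w : SignedPerm n) → fun w ∈ map fun (signedPerms n)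
    signedPerms-complete w =
      ∈-resp-≈ (FnSetoid n) (λ p → sym (w≗x p)) (subst (fun (decode x) ∈_) (map-∘ (codes n))
        (∈-map⁺ (setoid (Code n)) (FnSetoid n) (λ { refl _ → refl }) (codes-complete x)))
      where
      x = proj₁ (decode-surjective w)
      w≗x = proj₂ (decode-surjective w)

  -- Burnt pancake flips

  fpos-≤ : ∀ {n} (i a : Fin n) → toℕ a ≤ toℕ i →
           ∃ λ b → fpos i a ≡ (true , b) × toℕ b ≡ toℕ i ∸ toℕ a
  fpos-≤ i a a≤i with toℕ a ≤? toℕ i
  ... | yes _   = _ , refl , toℕ-fromℕ< _
  ... | no  a≰i = contradiction a≤i a≰i

  fpos-≰ : ∀ {n} (i a : Fin n) → ¬ toℕ a ≤ toℕ i → fpos i a ≡ (false , a)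
  fpos-≰ i a a≰i with toℕ a ≤? toℕ i
  ... | yes a≤i = contradiction a≤i a≰i
  ... | no  _   = refl

  fpos-involutive : ∀ {n} (i a : Fin n) → fpos i (proj₂ (fpos i a)) ≡ (proj₁ (fpos i a) , a)
  fpos-involutive i a = by-cases (toℕ a ≤? toℕ i)
    where
    by-cases : Dec (toℕ a ≤ toℕ i) → fpos i (proj₂ (fpos i a)) ≡ (proj₁ (fpos i a) , a)
    by-cases (no a≰i) rewrite fpos-≰ i a a≰i = fpos-≰ i a a≰i
    by-cases (yes a≤i) with fpos-≤ i a a≤i
    ... | b , fa≡b , b≡i∸a rewrite fa≡b
        with fpos-≤ i b (subst (_≤ toℕ i) (sym b≡i∸a) (m∸n≤m (toℕ i) (toℕ a)))
    ... | b′ , fb≡b′ , b′≡i∸b = trans fb≡b′ (cong (true ,_) (toℕ-injective (begin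
      toℕ b′                  ≡⟨ b′≡i∸b ⟩
      toℕ i ∸ toℕ b           ≡⟨ cong (toℕ i ∸_) b≡i∸a ⟩
      toℕ i ∸ (toℕ i ∸ toℕ a) ≡⟨ m∸[m∸n]≡n a≤i ⟩
      toℕ a                   ∎)))
      where open ≡-Reasoning

  fB-involutive : ∀ {n} (i : Fin n) x → fB i (fB i x) ≡ x
  fB-involutive i (s , a) rewrite fpos-involutive i a = cong (_, a) xor-cancel
    where
    t = proj₁ (fpos i a)
    xor-cancel : t xor (t xor s) ≡ s
    xor-cancel = trans (sym (xor-assoc t t s)) (cong (_xor s) (xor-same t))

  fB-odd : ∀ {n} (i : Fin n) x → fB i (neg x) ≡ neg (fB i x)
  fB-odd i (s , a) = cong (_, proj₂ (fpos i a)) (sym (not-distribʳ-xor (proj₁ (fpos i a)) s))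

  fB-≢-idF : ∀ {n} (i : Fin n) → ¬ (fB i ≗ idF)
  fB-≢-idF i fi≗id with fpos-≤ i i ≤-refl | cong proj₁ (fi≗id (false , i))
  ... | _ , fi≡b , _ | flips-sign rewrite fi≡b with () ← flips-sign

  -- Alternating walks

  pow-comm : ∀ {n} m (g : Fn n) x → pow m g (g x) ≡ g (pow m g x)
  pow-comm zero    g x = refl
  pow-comm (suc m) g x = cong g (pow-comm m g x)

  even-or-odd : ∀ m → ∃ λ q → m ≡ q + q ⊎ m ≡ suc (q + q)
  even-or-odd zero    = 0 , inj₁ refl
  even-or-odd (suc m) with even-or-odd m
  ... | q , inj₁ m≡2q   = q , inj₂ (cong suc m≡2q)
  ... | q , inj₂ m≡2q+1 = suc q , inj₁ (trans (cong suc m≡2q+1) (cong suc (sym (+-suc q q))))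

  module Alternation {n : ℕ} (i j : Fin n) where

    L : ℕ → Fn n
    L = letter i j

    A : ℕ → Fn n
    A = alt i j

    letter-involutive : ∀ t x → L t (L t x) ≡ x
    letter-involutive zero          = fB-involutive i
    letter-involutive (suc zero)    = fB-involutive j
    letter-involutive (suc (suc t)) = letter-involutive t

    letter-odd : ∀ t x → L t (neg x) ≡ neg (L t x)
    letter-odd zero          = fB-odd i
    letter-odd (suc zero)    = fB-odd j
    letter-odd (suc (suc t)) = letter-odd t

    letter-≢-idF : ∀ t → ¬ (L t ≗ idF)
    letter-≢-idF zero          = fB-≢-idF i
    letter-≢-idF (suc zero)    = fB-≢-idF j
    letter-≢-idF (suc (suc t)) = letter-≢-idF t

    letter-periodic : ∀ s q → L (s + (q + q)) ≡ L s
    letter-periodic s zero    = cong L (+-identityʳ s)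
    letter-periodic s (suc q) = trans (cong L s+2q+2≡) (letter-periodic s q)
      where
      s+2q+2≡ : s + (suc q + suc q) ≡ suc (suc (s + (q + q)))
      s+2q+2≡ = trans (+-suc s (q + suc q)) (cong suc (trans (cong (s +_) (+-suc q q)) (+-suc s (q + q))))

    letter-alternates : ∀ m t → L m ≡ L t ⊎ L m ≡ L (suc t)
    letter-alternates zero          zero          = inj₁ refl
    letter-alternates (suc zero)    zero          = inj₂ refl
    letter-alternates (suc (suc m)) zero          = letter-alternates m zero
    letter-alternates m             (suc zero)    with letter-alternates m zero
    ... | inj₁ Lm≡L0 = inj₂ Lm≡L0
    ... | inj₂ Lm≡L1 = inj₁ Lm≡L1
    letter-alternates m             (suc (suc t)) = letter-alternates m t

    even-length-last-letter : ∀ m → 1 ≤ m → ∃ λ p → 2 * m ≡ suc p × L p ≡ L 1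
    even-length-last-letter (suc m) _ = m + suc (m + 0) , refl , trans (cong L p≡) (letter-periodic 1 m)
      where
      p≡ : m + suc (m + 0) ≡ 1 + (m + m)
      p≡ = trans (+-suc m (m + 0)) (cong (λ z → suc (m + z)) (+-identityʳ m))

    alt-injective : ∀ t {x y} → A t x ≡ A t y → x ≡ y
    alt-injective zero    eq = eq
    alt-injective (suc t) {x} {y} eq = begin
      x             ≡⟨ letter-involutive t x ⟨
      L t (L t x)   ≡⟨ cong (L t) (alt-injective t eq) ⟩
      L t (L t y)   ≡⟨ letter-involutive t y ⟩
      y             ∎
      where open ≡-Reasoning

    alt-even : ∀ q → A (q + q) ≗ pow q (fB i · fB j)
    alt-even zero    x = refl
    alt-even (suc q) x rewrite +-suc q q | letter-periodic 0 q | letter-periodic 1 q =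
      trans (alt-even q (fB i (fB j x))) (pow-comm q (fB i · fB j) x)

    alt-cancel : ∀ s m → L m ≡ L s → A (suc s) ≗ A (suc m) → A s ≗ A m
    alt-cancel s m Lm≡Ls h x = begin
      A s x                  ≡⟨ cong (A s) (letter-involutive s x) ⟨
      A (suc s) (L s x)      ≡⟨ h (L s x) ⟩
      A m (L m (L s x))      ≡⟨ cong (λ g → A m (g (L s x))) Lm≡Ls ⟩
      A m (L s (L s x))      ≡⟨ cong (A m) (letter-involutive s x) ⟩
      A m x                  ∎
      where open ≡-Reasoning

    alt-fold : ∀ s m → L m ≡ L s → A s ≗ A (suc m) → A (suc s) ≗ A m
    alt-fold s m Lm≡Ls h x = begin
      A (suc s) x            ≡⟨ h (L s x) ⟩
      A m (L m (L s x))      ≡⟨ cong (λ g → A m (g (L s x))) Lm≡Ls ⟩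
      A m (L s (L s x))      ≡⟨ cong (A m) (letter-involutive s x) ⟩
      A m x                  ∎
      where open ≡-Reasoning

    alt-returns⇒pow-returns : ∀ s q → A s ≗ A (s + (q + q)) → pow q (fB i · fB j) ≗ idF
    alt-returns⇒pow-returns zero    q h x = trans (sym (alt-even q x)) (sym (h x))
    alt-returns⇒pow-returns (suc s) q h   =
      alt-returns⇒pow-returns s q (alt-cancel s (s + (q + q)) (letter-periodic s q) h)

    alt-≢-odd : ∀ q s → ¬ (A s ≗ A (s + suc (q + q)))
    alt-≢-odd zero    s h = letter-≢-idF s λ x →
      sym (alt-injective s (trans (h x) (cong (λ m → A m x) (+-comm s 1))))
    alt-≢-odd (suc q) s h = alt-≢-odd q (suc s) λ x →
      trans (alt-fold s M (letter-periodic s (suc q)) (λ y → trans (h y) (cong (λ m → A m y) (+-suc s _))) x)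
            (cong (λ m → A m x) M≡)
      where
      M = s + (suc q + suc q)
      M≡ : M ≡ suc s + suc (q + q)
      M≡ = trans (+-suc s (q + suc q)) (cong (λ m → suc (s + m)) (+-suc q q))

    letterˢ : ℕ → SignedPerm n
    letterˢ t = signedInvolution (L t) (letter-odd t) (letter-involutive t)

    vertexˢ : SignedPerm n → ℕ → SignedPerm n
    vertexˢ w zero    = w
    vertexˢ w (suc t) = vertexˢ w t ∘ˢ letterˢ t

    vertexˢ-fun : ∀ w t → fun (vertexˢ w t) ≗ vert i j w t
    vertexˢ-fun w zero    x = refl
    vertexˢ-fun w (suc t) x = vertexˢ-fun w t (L t x)

  -- The (f_i f_j)^k-cycles

  module Cycles {n : ℕ} (i j : Fin n) {k : ℕ} (k-isOrder : IsOrder k (fB i · fB j)) where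
    open Alternation i j

    ℓ : ℕ
    ℓ = 2 * k

    2*k≡k+k : 2 * k ≡ k + k
    2*k≡k+k = cong (k +_) (+-identityʳ k)

    0<ℓ : 0 < ℓ
    0<ℓ = ≤-trans (proj₁ k-isOrder) (m≤m+n k _)

    alt-distinct : ∀ {s t} → s < t → t < ℓ → ¬ (A s ≗ A t)
    alt-distinct {s} {t} s<t t<ℓ As≗At with m≤n⇒∃[o]m+o≡n s<t
    ... | o , s+1+o≡t with even-or-odd o
    ...   | q , inj₁ o≡2q   = alt-≢-odd q s λ x → trans (As≗At x) (cong (λ m → A m x) (sym t≡))
      where
      t≡ : s + suc (q + q) ≡ t
      t≡ = trans (+-suc s (q + q)) (trans (cong (λ m → suc (s + m)) (sym o≡2q)) s+1+o≡t)
    ...   | q , inj₂ o≡2q+1 = proj₂ (proj₂ k-isOrder) (suc q) (s≤s z≤n) q+1<k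
      (alt-returns⇒pow-returns s (suc q) λ x → trans (As≗At x) (cong (λ m → A m x) (sym t≡)))
      where
      t≡ : s + (suc q + suc q) ≡ t
      t≡ = trans (+-suc s (q + suc q))
                 (trans (cong (λ m → suc (s + m)) (trans (+-suc q q) (sym o≡2q+1))) s+1+o≡t)
      q+1<k : suc q < k
      q+1<k = ≰⇒> λ k≤q+1 → <⇒≱ (subst (t <_) 2*k≡k+k t<ℓ)
        (≤-trans (+-mono-≤ k≤q+1 k≤q+1) (≤-trans (m≤n+m _ s) (≤-reflexive t≡)))

    vert-return : ∀ w → vert i j w ℓ ≗ fun w
    vert-return w x = cong (fun w) (begin
      A (2 * k) x                ≡⟨ cong (λ m → A m x) 2*k≡k+k ⟩
      A (k + k) x                ≡⟨ alt-even k x ⟩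
      pow k (fB i · fB j) x      ≡⟨ proj₁ (proj₂ k-isOrder) x ⟩
      x                          ∎)
      where open ≡-Reasoning

    vert-back : ∀ c t → vert i j c (suc t) · L t ≗ vert i j c t
    vert-back c t x = cong (vert i j c t) (letter-involutive t x)

    vert-injective : ∀ w {s t} → s < ℓ → t < ℓ → vert i j w s ≗ vert i j w t → s ≡ t
    vert-injective w {s} {t} s<ℓ t<ℓ ws≗wt with <-cmp s t
    ... | tri≈ _ s≡t _ = s≡t
    ... | tri< s<t _ _ = ⊥-elim (alt-distinct s<t t<ℓ λ x → injective w (ws≗wt x))
    ... | tri> _ _ t<s = ⊥-elim (alt-distinct t<s s<ℓ λ x → injective w (sym (ws≗wt x)))

    isAltCycle : ∀ w → IsAltCycle i j ℓ w
    isAltCycle w = vert-return w , λ s t → vert-injective w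

    record OnCycle (c : SignedPerm n) (f : Fn n) : Set where
      constructor at
      field
        index   : ℕ
        index<ℓ : index < ℓ
        ≗vert   : f ≗ vert i j c index

    onCycle-resp : ∀ {c f g} → f ≗ g → OnCycle c g → OnCycle c f
    onCycle-resp f≗g (at t t<ℓ g≗ct) = at t t<ℓ λ x → trans (f≗g x) (g≗ct x)

    onCycle-forward : ∀ {c f} t → t < ℓ → f ≗ vert i j c t → OnCycle c (f · L t)
    onCycle-forward {c} t t<ℓ f≗ct with m≤n⇒m<n∨m≡n t<ℓ
    ... | inj₁ t+1<ℓ = at (suc t) t+1<ℓ λ x → f≗ct (L t x)
    ... | inj₂ t+1≡ℓ = at 0 0<ℓ λ x →
      trans (f≗ct (L t x)) (trans (cong (λ s → vert i j c s x) t+1≡ℓ) (vert-return c x))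

    onCycle-backward : ∀ {c f} t → t < ℓ → f ≗ vert i j c t → OnCycle c (f · L (suc t))
    onCycle-backward {c} (suc t) t+1<ℓ f≗ct =
      at t (<-trans (n<1+n t) t+1<ℓ) λ x → trans (f≗ct (L t x)) (vert-back c t x)
    onCycle-backward {c} {f} zero _ f≗c0 with even-length-last-letter k (proj₁ k-isOrder)
    ... | p , ℓ≡p+1 , Lp≡L1 = at p (subst (p <_) (sym ℓ≡p+1) (n<1+n p)) λ x → begin
      f (L 1 x)                      ≡⟨ f≗c0 (L 1 x) ⟩
      fun c (L 1 x)                  ≡⟨ vert-return c (L 1 x) ⟨
      vert i j c ℓ (L 1 x)           ≡⟨ cong (λ s → vert i j c s (L 1 x)) ℓ≡p+1 ⟩
      vert i j c (suc p) (L 1 x)     ≡⟨ cong (λ g → vert i j c (suc p) (g x)) Lp≡L1 ⟨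
      vert i j c (suc p) (L p x)     ≡⟨ vert-back c p x ⟩
      vert i j c p x                 ∎
      where open ≡-Reasoning

    onCycle-step : ∀ {c f} m → OnCycle c f → OnCycle c (f · L m)
    onCycle-step {f = f} m (at t t<ℓ f≗ct) with letter-alternates m t
    ... | inj₁ Lm≡Lt   = onCycle-resp (λ x → cong (λ g → f (g x)) Lm≡Lt)   (onCycle-forward t t<ℓ f≗ct)
    ... | inj₂ Lm≡Lt+1 = onCycle-resp (λ x → cong (λ g → f (g x)) Lm≡Lt+1) (onCycle-backward t t<ℓ f≗ct)

    onCycle-vert⇒onCycle-start : ∀ {c} w t → OnCycle c (vert i j w t) → OnCycle c (fun w)
    onCycle-vert⇒onCycle-start w zero    onc = onc
    onCycle-vert⇒onCycle-start w (suc t) onc = onCycle-vert⇒onCycle-start w t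
      (onCycle-resp (λ x → sym (vert-back w t x)) (onCycle-step t onc))

    onCycle⇒¬vertexDisjoint : ∀ {c w} → OnCycle c (fun w) → ¬ VertexDisjoint i j ℓ c w
    onCycle⇒¬vertexDisjoint (at t t<ℓ w≗ct) disjoint = disjoint t 0 t<ℓ 0<ℓ λ x → sym (w≗ct x)

    ¬onCycle⇒vertexDisjoint : ∀ {c w} → ¬ OnCycle c (fun w) → VertexDisjoint i j ℓ w c
    ¬onCycle⇒vertexDisjoint {w = w} ¬onc s t _ t<ℓ ws≗ct =
      ¬onc (onCycle-vert⇒onCycle-start w s (at t t<ℓ ws≗ct))

    vertexDisjoint⇒¬onBoth : ∀ {c c′ f} → VertexDisjoint i j ℓ c c′ → OnCycle c f → ¬ OnCycle c′ f
    vertexDisjoint⇒¬onBoth c∥c′ (at s s<ℓ f≗cs) (at t t<ℓ f≗c′t) =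
      c∥c′ s t s<ℓ t<ℓ λ x → trans (sym (f≗cs x)) (f≗c′t x)

    onCycle? : ∀ c f → Dec (OnCycle c f)
    onCycle? c f = map′ (λ (t , t<ℓ , f≗ct) → at t t<ℓ f≗ct) (λ (at t t<ℓ f≗ct) → t , t<ℓ , f≗ct)
                        (anyUpTo? (λ t → f ≗? vert i j c t) ℓ)

  module CycleSelection {n : ℕ} (i j : Fin n) {k : ℕ} (k-isOrder : IsOrder k (fB i · fB j)) where
    open Alternation i j
    open Cycles i j k-isOrder
    open import Data.List.Membership.Setoid (FnSetoid n) using (_∈_)
    open import Data.List.Relation.Binary.Subset.Setoid (FnSetoid n) using (_⊆_)

    Covered : Fn n → List (SignedPerm n) → Set
    Covered f cs = Any (λ c → OnCycle c f) cs

    select : List (SignedPerm n) → List (SignedPerm n) → List (SignedPerm n)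
    select cs []       = cs
    select cs (w ∷ ws) with Any.any? (λ c → onCycle? c (fun w)) cs
    ... | yes _ = select cs ws
    ... | no  _ = select (w ∷ cs) ws

    select-preserves-covered : ∀ {f} cs ws → Covered f cs → Covered f (select cs ws)
    select-preserves-covered cs []       cov = cov
    select-preserves-covered cs (w ∷ ws) cov with Any.any? (λ c → onCycle? c (fun w)) cs
    ... | yes _ = select-preserves-covered cs ws cov
    ... | no  _ = select-preserves-covered (w ∷ cs) ws (there cov)

    select-covers : ∀ cs ws → All (λ w → Covered (fun w) (select cs ws)) ws
    select-covers cs []       = []
    select-covers cs (w ∷ ws) with Any.any? (λ c → onCycle? c (fun w)) cs
    ... | yes cov = select-preserves-covered cs ws cov ∷ select-covers cs ws
    ... | no  _   = select-preserves-covered (w ∷ cs) ws (here (at 0 0<ℓ λ _ → refl))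
                  ∷ select-covers (w ∷ cs) ws

    select-vertexDisjoint : ∀ cs ws → AllPairs (VertexDisjoint i j ℓ) cs →
                            AllPairs (VertexDisjoint i j ℓ) (select cs ws)
    select-vertexDisjoint cs []       disjoint = disjoint
    select-vertexDisjoint cs (w ∷ ws) disjoint with Any.any? (λ c → onCycle? c (fun w)) cs
    ... | yes _         = select-vertexDisjoint cs ws disjoint
    ... | no  uncovered = select-vertexDisjoint (w ∷ cs) ws
      (All.map (λ {c} → ¬onCycle⇒vertexDisjoint {c} {w}) (All.¬Any⇒All¬ cs uncovered) ∷ disjoint)

    cycle : SignedPerm n → List (Fn n)
    cycle c = applyUpTo (vert i j c) ℓ

    vertices : List (SignedPerm n) → List (Fn n)
    vertices cs = concat (map cycle cs)

    length-vertices : ∀ cs → length (vertices cs) ≡ length cs * ℓ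
    length-vertices []       = refl
    length-vertices (c ∷ cs) =
      trans (length-++ (cycle c)) (cong₂ _+_ (length-applyUpTo (vert i j c) ℓ) (length-vertices cs))

    ∈-cycle⁻ : ∀ {f} c → f ∈ cycle c → OnCycle c f
    ∈-cycle⁻ c f∈ with Any.applyUpTo⁻ (vert i j c) f∈
    ... | t , t<ℓ , f≗ct = at t t<ℓ f≗ct

    ∈-cycle⁺ : ∀ {f c} → OnCycle c f → f ∈ cycle c
    ∈-cycle⁺ (at t t<ℓ f≗ct) = Any.applyUpTo⁺ _ f≗ct t<ℓ

    ∈-vertices⁻ : ∀ {f} cs → f ∈ vertices cs → Covered f cs
    ∈-vertices⁻ cs f∈ = Any.map (∈-cycle⁻ _) (Any.map⁻ (Any.concat⁻ (map cycle cs) f∈))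

    ∈-vertices⁺ : ∀ {f cs} → Covered f cs → f ∈ vertices cs
    ∈-vertices⁺ cov = Any.concat⁺ (Any.map⁺ (Any.map ∈-cycle⁺ cov))

    cycle-unique : ∀ c → Unique (FnSetoid n) (cycle c)
    cycle-unique c = Unique.applyUpTo⁺₁ (FnSetoid n) (vert i j c) ℓ
      λ s<t t<ℓ cs≗ct → alt-distinct s<t t<ℓ λ x → injective c (cs≗ct x)

    vertices-unique : ∀ {cs} → AllPairs (VertexDisjoint i j ℓ) cs → Unique (FnSetoid n) (vertices cs)
    vertices-unique {cs} disjoint = Unique.concat⁺ (FnSetoid n)
      (All.map⁺ (All.universal cycle-unique cs))
      (AllPairs.map⁺ (AllPairs.map (λ {c} {c′} c∥c′ {_} (f∈c , f∈c′) →
        vertexDisjoint⇒¬onBoth c∥c′ (∈-cycle⁻ c f∈c) (∈-cycle⁻ c′ f∈c′)) disjoint))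

    vertices⊆signedPerms : ∀ cs → vertices cs ⊆ map fun (signedPerms n)
    vertices⊆signedPerms cs f∈ with Any.satisfied (∈-vertices⁻ cs f∈)
    ... | c , at t _ f≗ct = ∈-resp-≈ (FnSetoid n) (λ x → trans (vertexˢ-fun c t x) (sym (f≗ct x)))
                              (signedPerms-complete (vertexˢ c t))

    representatives : List (SignedPerm n)
    representatives = select [] (signedPerms n)

    representatives-altCycles : All (IsAltCycle i j ℓ) representatives
    representatives-altCycles = All.universal isAltCycle representatives

    representatives-vertexDisjoint : AllPairs (VertexDisjoint i j ℓ) representatives
    representatives-vertexDisjoint = select-vertexDisjoint [] (signedPerms n) []

    signedPerms-covered : ∀ {f} → f ∈ map fun (signedPerms n) → Covered f representatives
    signedPerms-covered f∈ with ∈-map⁻ (setoid (SignedPerm n)) (FnSetoid n) f∈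
    ... | w , w∈ , f≗w = Any.map (onCycle-resp f≗w) (All.lookup (select-covers [] (signedPerms n)) w∈)

    representatives-maximal : ∀ w → Any (λ c → ¬ VertexDisjoint i j ℓ c w) representatives
    representatives-maximal w =
      Any.map (onCycle⇒¬vertexDisjoint {w = w}) (signedPerms-covered (signedPerms-complete w))

    representatives-count : length representatives * ℓ ≡ 2 ^ n * n !
    representatives-count = begin
      length representatives * ℓ          ≡⟨ length-vertices representatives ⟨
      length (vertices representatives)   ≡⟨ ≤-antisym
        (Unique∧⊆⇒length≤ (FnSetoid n) (vertices-unique representatives-vertexDisjoint)
                                        (vertices⊆signedPerms representatives))
        (Unique∧⊆⇒length≤ (FnSetoid n) (signedPerms-unique n) (∈-vertices⁺ ∘ signedPerms-covered)) ⟩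
      length (map fun (signedPerms n))    ≡⟨ length-map fun (signedPerms n) ⟩
      length (signedPerms n)              ≡⟨ length-map decode (codes n) ⟩
      length (codes n)                    ≡⟨ length-codes n ⟩
      2 ^ n * n !                         ∎
      where open ≡-Reasoning

open BurntPancakeGraph
open import Data.Nat using (ℕ; _≤_; _*_; _^_; _!)
open import Data.Fin using (Fin; _<_)
open import Data.Product using (_×_; Σ; _,_)
open import Data.List using (List; length)
open import Relation.Binary.PropositionalEquality using (_≡_)

theorem4p3 : (n : ℕ) → 2 ≤ n → (i j : Fin n) → i < j → (k : ℕ) →
    IsOrder k (fB i · fB j) →
    Σ (List (SignedPerm n)) (λ cs →
    (length cs * (2 * k) ≡ 2 ^ n * n !) × MaximalIndependentAltCycles i j (2 * k) cs)
theorem4p3 n _ i j _ k k-isOrder =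
  representatives , representatives-count ,
  representatives-altCycles , representatives-vertexDisjoint , λ w _ → representatives-maximal w
  where open CycleSelection i j k-isOrder
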